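{- Let $(G, \phi, (g_1, \dots, g_n))$ be an $n$-expansion group and let $i \in \mathbb{Z}_{\geq 2}$. Then $I^{i - 2} \cdot G^{(2)} = G^{(i)}$, where $I$ is the augmentation ideal of $\mathbb{F}_2[G/[G,G]]$ and $I^0$ denotes the whole ring.
   Context: $V_{[n]}=\mathbb{F}_2^n$ with standard basis $e_i$. Group commutator $[x,y]=xyx^{ -1}y^{ -1}$; $G^{(1)}=G$, $G^{(i+1)}=[G,G^{(i)}]$. An $n$-expansion group is a triple $(G,\phi,(g_1,\dots,g_n))$ with $G$ a group, $\phi:G\to V_{[n]}$ a homomorphism, $g_i\in G$, $\phi(g_i)=e_i$, $\ker\phi$ an elementary abelian $2$-group, $[G,G]=\ker\phi$, and $g_i^2=1$. Since $[G,G]$ is an elementary abelian $2$-group on which $G$ acts by conjugation through $G/[G,G]$, it is a module (written additively) over the group ring $\mathbb{F}_2[G/[G,G]]$, and so is every normal subgroup of $G$ contained in $[G,G]$; products $I^k\cdot G^{(2)}$ are taken in this module. -}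

module Defs where

open import Level using (_⊔_)
open import Algebra.Bundles using (Group)
open import Data.Nat using (ℕ; zero; suc)
open import Data.Fin using (Fin)
open import Data.Fin.Properties using (_≟_)
open import Data.Bool using (Bool; true; false; not; _xor_)
open import Data.Vec using (Vec; zipWith; replicate; tabulate)
open import Data.List using (List; []; _∷_; _++_; map; concatMap)
open import Data.Product using (Σ; _×_; _,_)
open import Data.Unit.Polymorphic using (⊤)
open import Relation.Nullary using (does)
open import Relation.Binary.PropositionalEquality using (_≡_)

V : ℕ → Set
V n = Vec Bool n

_⊕_ : ∀ {n} → V n → V n → V n
_⊕_ = zipWith _xor_

0V : ∀ n → V n
0V n = replicate n false

e : ∀ {n} → Fin n → V n
e i = tabulate (λ j → does (i ≟ j))

module GroupNotions {c ℓ} (G : Group c ℓ) where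
  open Group G

  Pred : Set (Level.suc (c ⊔ ℓ))
  Pred = Carrier → Set (c ⊔ ℓ)

  [_,_] : Carrier → Carrier → Carrier
  [ x , y ] = ((x ∙ y) ∙ x ⁻¹) ∙ y ⁻¹

  data Gen (S : Pred) : Pred where
    gen  : ∀ {x} → S x → Gen S x
    unit : Gen S ε
    mul  : ∀ {x y} → Gen S x → Gen S y → Gen S (x ∙ y)
    inv  : ∀ {x} → Gen S x → Gen S (x ⁻¹)
    resp : ∀ {x y} → x ≈ y → Gen S x → Gen S y

  Comms : Pred → Pred
  Comms N x = Σ Carrier λ g → Σ Carrier λ h → N h × (x ≈ [ g , h ])

  -- lower central series: LCS i = G^(i) for i ≥ 1;
  -- G^(1) = G, G^(i+1) = [G, G^(i)].  (LCS 0 := G is an unused convention.)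
  LCS : ℕ → Pred
  LCS zero = λ _ → ⊤
  LCS (suc zero) = λ _ → ⊤
  LCS (suc (suc i)) = Gen (Comms (LCS (suc i)))

  Comm : Pred
  Comm = LCS 2

  -- An element of F_2[G] is represented by a list of group
  -- elements (formal F_2-sum); it maps onto F_2[G/[G,G]].
  -- Conjugation action on [G,G] (written additively = group product):
  --   (Σ h_j) · m = Π_j (h_j m h_j⁻¹).
  act : List Carrier → Carrier → Carrier
  act []      m = ε
  act (h ∷ r) m = ((h ∙ m) ∙ h ⁻¹) ∙ act r m

  _*R_ : List Carrier → List Carrier → List Carrier
  a *R b = concatMap (λ x → map (x ∙_) b) a

  aug : List Carrier → Bool
  aug []      = false
  aug (_ ∷ r) = not (aug r)

  InI : List Carrier → Set
  InI r = aug r ≡ false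

  data Pow : ℕ → List Carrier → Set c where
    whole : ∀ r → Pow zero r
    prod  : ∀ {k} a b → InI a → Pow k b → Pow (suc k) (a *R b)
    zeroP : ∀ {k} → Pow k []
    sumP  : ∀ {k r s} → Pow k r → Pow k s → Pow k (r ++ s)

  PowMod : ℕ → Pred → Pred
  PowMod k N = Gen (λ x → Σ (List Carrier) λ r → Σ Carrier λ m →
                      Pow k r × N m × (x ≈ act r m))

record IsExpansionGroup {c ℓ} (n : ℕ) (G : Group c ℓ)
         (φ : Group.Carrier G → V n) (g : Fin n → Group.Carrier G)
         : Set (c ⊔ ℓ) where
  open Group G
  open GroupNotions G
  field
    φ-cong : ∀ {x y} → x ≈ y → φ x ≡ φ y
    φ-hom  : ∀ x y → φ (x ∙ y) ≡ φ x ⊕ φ y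
    φ-g    : ∀ i → φ (g i) ≡ e i
    ker-comm : ∀ x y → φ x ≡ 0V n → φ y ≡ 0V n → (x ∙ y) ≈ (y ∙ x)
    ker-sq   : ∀ x → φ x ≡ 0V n → (x ∙ x) ≈ ε
    comm⊆ker : ∀ x → Comm x → φ x ≡ 0V n
    ker⊆comm : ∀ x → φ x ≡ 0V n → Comm x
    g-sq   : ∀ i → (g i ∙ g i) ≈ ε

module Submission where

-- Only one feature of expansion groups is used: the commutator subgroup
-- K = [G,G] is an elementary abelian 2-group.
--
-- Write m ↦ r·m for the conjugation action of a formal sum r = Σ h_j on K.
-- Two identities drive the proof.  For y ∈ K and a = h₁ + h₂ + r, with a in
-- the augmentation ideal I,  a·y = [h₁,y] [h₂,y] (r·y),  because
-- h y h⁻¹ = [h,y] y and y² = 1; hence I·(X ∩ K) ⊆ [G,X] for every X.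
-- Conversely [h,y] = (h + 1)·y with h + 1 ∈ I.  Induction on k then gives
--   I^k·K ⊆ G^(k+2)   (first identity, with (ab)·m = a·(b·m)), and
--   G^(k+2) ⊆ I^k·K   (second identity, using that y ↦ a·y is additive on K).

open import Defs
open import Level using (Level)
open import Algebra.Bundles using (Group)
open import Data.Nat using (ℕ; _≤_; _∸_; zero; suc; s≤s; z≤n)
open import Data.Fin using (Fin)
open import Data.Product using (_×_; _,_)
open import Data.List using ([]; _∷_; _++_; map)
open import Data.Bool.Properties using (not-involutive)
open import Data.Unit.Polymorphic using (tt)
import Relation.Binary.PropositionalEquality as ≡
import Relation.Binary.Reasoning.Setoid as SetoidReasoning
import Algebra.Properties.Group as GroupProperties

module GroupFacts {c ℓ} (G : Group c ℓ) where
  open Group G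
  open GroupNotions G
  open GroupProperties G using (⁻¹-anti-homo-∙; ε⁻¹≈ε)
  open SetoidReasoning setoid

  Gen-⊆ : ∀ {S T : Pred} → (∀ {x} → S x → Gen T x) → ∀ {x} → Gen S x → Gen T x
  Gen-⊆ f (gen s)    = f s
  Gen-⊆ f unit       = unit
  Gen-⊆ f (mul p q)  = mul (Gen-⊆ f p) (Gen-⊆ f q)
  Gen-⊆ f (inv p)    = inv (Gen-⊆ f p)
  Gen-⊆ f (resp e p) = resp e (Gen-⊆ f p)

  conj : Carrier → Carrier → Carrier
  conj h m = (h ∙ m) ∙ h ⁻¹

  conj-cong : ∀ h {x y} → x ≈ y → conj h x ≈ conj h y
  conj-cong h x≈y = ∙-cong (∙-cong refl x≈y) refl

  conj≈commutator∙ : ∀ h m → conj h m ≈ [ h , m ] ∙ m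
  conj≈commutator∙ h m = sym (begin
    (conj h m ∙ m ⁻¹) ∙ m ≈⟨ assoc _ _ _ ⟩
    conj h m ∙ (m ⁻¹ ∙ m) ≈⟨ ∙-cong refl (inverseˡ m) ⟩
    conj h m ∙ ε          ≈⟨ identityʳ _ ⟩
    conj h m              ∎)

  conj-∙ : ∀ h x y → conj h (x ∙ y) ≈ conj h x ∙ conj h y
  conj-∙ h x y = sym (begin
    ((h ∙ x) ∙ h ⁻¹) ∙ ((h ∙ y) ∙ h ⁻¹) ≈⟨ sym (assoc _ _ _) ⟩
    (((h ∙ x) ∙ h ⁻¹) ∙ (h ∙ y)) ∙ h ⁻¹ ≈⟨ ∙-cong cancel refl ⟩
    ((h ∙ x) ∙ y) ∙ h ⁻¹                 ≈⟨ ∙-cong (assoc _ _ _) refl ⟩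
    (h ∙ (x ∙ y)) ∙ h ⁻¹                 ∎)
    where
    cancel : ((h ∙ x) ∙ h ⁻¹) ∙ (h ∙ y) ≈ (h ∙ x) ∙ y
    cancel = begin
      ((h ∙ x) ∙ h ⁻¹) ∙ (h ∙ y) ≈⟨ assoc _ _ _ ⟩
      (h ∙ x) ∙ (h ⁻¹ ∙ (h ∙ y)) ≈⟨ ∙-cong refl (sym (assoc _ _ _)) ⟩
      (h ∙ x) ∙ ((h ⁻¹ ∙ h) ∙ y) ≈⟨ ∙-cong refl (∙-cong (inverseˡ h) refl) ⟩
      (h ∙ x) ∙ (ε ∙ y)          ≈⟨ ∙-cong refl (identityˡ y) ⟩
      (h ∙ x) ∙ y                ∎

  conj-ε : ∀ h → conj h ε ≈ ε
  conj-ε h = trans (∙-cong (identityʳ h) refl) (inverseʳ h)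

  conj-identity : ∀ m → conj ε m ≈ m
  conj-identity m = trans (∙-cong (identityˡ m) ε⁻¹≈ε) (identityʳ m)

  conj-∙-action : ∀ h k m → conj (h ∙ k) m ≈ conj h (conj k m)
  conj-∙-action h k m = begin
    ((h ∙ k) ∙ m) ∙ (h ∙ k) ⁻¹      ≈⟨ ∙-cong refl (⁻¹-anti-homo-∙ h k) ⟩
    ((h ∙ k) ∙ m) ∙ (k ⁻¹ ∙ h ⁻¹)   ≈⟨ sym (assoc _ _ _) ⟩
    (((h ∙ k) ∙ m) ∙ k ⁻¹) ∙ h ⁻¹   ≈⟨ ∙-cong (∙-cong (assoc _ _ _) refl) refl ⟩
    ((h ∙ (k ∙ m)) ∙ k ⁻¹) ∙ h ⁻¹   ≈⟨ ∙-cong (assoc _ _ _) refl ⟩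
    (h ∙ ((k ∙ m) ∙ k ⁻¹)) ∙ h ⁻¹   ∎

  act-cong : ∀ a {x y} → x ≈ y → act a x ≈ act a y
  act-cong []      x≈y = refl
  act-cong (h ∷ a) x≈y = ∙-cong (conj-cong h x≈y) (act-cong a x≈y)

  act-++ : ∀ r s m → act (r ++ s) m ≈ act r m ∙ act s m
  act-++ []      s m = sym (identityˡ _)
  act-++ (h ∷ r) s m = begin
    conj h m ∙ act (r ++ s) m        ≈⟨ ∙-cong refl (act-++ r s m) ⟩
    conj h m ∙ (act r m ∙ act s m)   ≈⟨ sym (assoc _ _ _) ⟩
    (conj h m ∙ act r m) ∙ act s m   ∎

  act-ε : ∀ a → act a ε ≈ ε
  act-ε []      = refl
  act-ε (h ∷ a) = trans (∙-cong (conj-ε h) (act-ε a)) (identityˡ ε)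

  act-unit : ∀ m → act (ε ∷ []) m ≈ m
  act-unit m = trans (∙-cong (conj-identity m) refl) (identityʳ m)

  act-translate : ∀ h b m → act (map (h ∙_) b) m ≈ conj h (act b m)
  act-translate h []      m = sym (conj-ε h)
  act-translate h (k ∷ b) m = begin
    conj (h ∙ k) m ∙ act (map (h ∙_) b) m
      ≈⟨ ∙-cong (conj-∙-action h k m) (act-translate h b m) ⟩
    conj h (conj k m) ∙ conj h (act b m) ≈⟨ sym (conj-∙ h _ _) ⟩
    conj h (conj k m ∙ act b m)          ∎

  act-*R : ∀ a b m → act (a *R b) m ≈ act a (act b m)
  act-*R []      b m = refl
  act-*R (h ∷ a) b m = begin
    act (map (h ∙_) b ++ (a *R b)) m       ≈⟨ act-++ (map (h ∙_) b) (a *R b) m ⟩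
    act (map (h ∙_) b) m ∙ act (a *R b) m  ≈⟨ ∙-cong (act-translate h b m) (act-*R a b m) ⟩
    conj h (act b m) ∙ act a (act b m)     ∎

module ElementaryAbelianCommutator {c ℓ} (G : Group c ℓ)
    (K-comm : ∀ {x y} → GroupNotions.Comm G x → GroupNotions.Comm G y →
              Group._≈_ G (Group._∙_ G x y) (Group._∙_ G y x))
    (K-sq : ∀ {x} → GroupNotions.Comm G x →
            Group._≈_ G (Group._∙_ G x x) (Group.ε G)) where
  open Group G
  open GroupNotions G
  open GroupFacts G
  open GroupProperties G using (inverseˡ-unique)
  open SetoidReasoning setoid

  K : Pred
  K = Comm

  commutator∈K : ∀ h m → K [ h , m ]
  commutator∈K h m = gen (h , m , tt , refl)

  LCS⊆K : ∀ k {x} → LCS (suc (suc k)) x → K x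
  LCS⊆K k = Gen-⊆ (λ { (h , m , _ , x≈[h,m]) → resp (sym x≈[h,m]) (commutator∈K h m) })

  K-inv : ∀ {x} → K x → x ⁻¹ ≈ x
  K-inv {x} kx = sym (inverseˡ-unique x x (K-sq kx))

  -- K is normal, hence stable under the action of formal sums.
  conj∈K : ∀ h {m} → K m → K (conj h m)
  conj∈K h {m} km = resp (sym (conj≈commutator∙ h m)) (mul (commutator∈K h m) km)

  act∈K : ∀ r {m} → K m → K (act r m)
  act∈K []      km = unit
  act∈K (h ∷ r) km = mul (conj∈K h km) (act∈K r km)

  -- On K the action of a formal sum is a group endomorphism
  -- (K is abelian, so the factors may be regrouped).
  act-∙ : ∀ a {x y} → K x → K y → act a (x ∙ y) ≈ act a x ∙ act a y
  act-∙ []      kx ky = sym (identityˡ ε)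
  act-∙ (h ∷ a) {x} {y} kx ky = begin
    conj h (x ∙ y) ∙ act a (x ∙ y)               ≈⟨ ∙-cong (conj-∙ h x y) (act-∙ a kx ky) ⟩
    (conj h x ∙ conj h y) ∙ (act a x ∙ act a y)  ≈⟨ assoc _ _ _ ⟩
    conj h x ∙ (conj h y ∙ (act a x ∙ act a y))  ≈⟨ ∙-cong refl (sym (assoc _ _ _)) ⟩
    conj h x ∙ ((conj h y ∙ act a x) ∙ act a y)
      ≈⟨ ∙-cong refl (∙-cong (K-comm (conj∈K h ky) (act∈K a kx)) refl) ⟩
    conj h x ∙ ((act a x ∙ conj h y) ∙ act a y)  ≈⟨ ∙-cong refl (assoc _ _ _) ⟩
    conj h x ∙ (act a x ∙ (conj h y ∙ act a y))  ≈⟨ sym (assoc _ _ _) ⟩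
    (conj h x ∙ act a x) ∙ (conj h y ∙ act a y)  ∎

  act-⁻¹ : ∀ a {x} → K x → act a (x ⁻¹) ≈ act a x ⁻¹
  act-⁻¹ a kx = trans (act-cong a (K-inv kx)) (sym (K-inv (act∈K a kx)))

  -- For y ∈ K: h y h⁻¹ · h' y h'⁻¹ = [h,y] [h',y], since y commutes with
  -- commutators and y² = 1.
  conj-pair : ∀ h h' {y} → K y → conj h y ∙ conj h' y ≈ [ h , y ] ∙ [ h' , y ]
  conj-pair h h' {y} ky = begin
    conj h y ∙ conj h' y  ≈⟨ ∙-cong (conj≈commutator∙ h y) (conj≈commutator∙ h' y) ⟩
    (u ∙ y) ∙ (u' ∙ y)    ≈⟨ ∙-cong refl (K-comm (commutator∈K h' y) ky) ⟩
    (u ∙ y) ∙ (y ∙ u')    ≈⟨ assoc _ _ _ ⟩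
    u ∙ (y ∙ (y ∙ u'))    ≈⟨ ∙-cong refl (sym (assoc _ _ _)) ⟩
    u ∙ ((y ∙ y) ∙ u')    ≈⟨ ∙-cong refl (∙-cong (K-sq ky) refl) ⟩
    u ∙ (ε ∙ u')          ≈⟨ ∙-cong refl (identityˡ u') ⟩
    u ∙ u'                ∎
    where
    u u' : Carrier
    u  = [ h , y ]
    u' = [ h' , y ]

  -- The key identity: I·(X ∩ K) ⊆ [G,X].  An element of I has an even number
  -- of terms, which are paired off by conj-pair.
  augmentation-act∈commutators : ∀ (X : Pred) a {y} → InI a → X y → K y →
                                 Gen (Comms X) (act a y)
  augmentation-act∈commutators X []            a∈I xy ky = unit
  augmentation-act∈commutators X (h ∷ [])      ()  xy ky
  augmentation-act∈commutators X (h ∷ h' ∷ r) {y} a∈I xy ky =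
    resp (sym regroup)
      (mul (mul (gen (h , y , xy , refl)) (gen (h' , y , xy , refl)))
           (augmentation-act∈commutators X r r∈I xy ky))
    where
    r∈I : InI r
    r∈I = ≡.trans (≡.sym (not-involutive _)) a∈I
    regroup : conj h y ∙ (conj h' y ∙ act r y) ≈ ([ h , y ] ∙ [ h' , y ]) ∙ act r y
    regroup = trans (sym (assoc _ _ _)) (∙-cong (conj-pair h h' ky) refl)

  commutator≈act : ∀ h {y} → K y → [ h , y ] ≈ act (h ∷ ε ∷ []) y
  commutator≈act h {y} ky = ∙-cong refl (trans (K-inv ky) (sym (act-unit y)))

  Pow-act∈LCS : ∀ {k r m} → Pow k r → K m → LCS (suc (suc k)) (act r m)
  Pow-act∈LCS (whole r) km = act∈K r km
  Pow-act∈LCS {m = m} (prod a b a∈I b∈Iᵏ) km =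
    resp (sym (act-*R a b m))
         (augmentation-act∈commutators _ a a∈I (Pow-act∈LCS b∈Iᵏ km) (act∈K b km))
  Pow-act∈LCS zeroP km = unit
  Pow-act∈LCS {m = m} (sumP {r = r} {s = s} pr ps) km =
    resp (sym (act-++ r s m)) (mul (Pow-act∈LCS pr km) (Pow-act∈LCS ps km))

  PowMod⊆LCS : ∀ k {x} → PowMod k K x → LCS (suc (suc k)) x
  PowMod⊆LCS k = Gen-⊆ (λ { (r , m , r∈Iᵏ , km , x≈r·m) →
    resp (sym x≈r·m) (Pow-act∈LCS r∈Iᵏ km) })

  PowMod⊆K : ∀ k {x} → PowMod k K x → K x
  PowMod⊆K k = Gen-⊆ (λ { (r , m , _ , km , x≈r·m) → resp (sym x≈r·m) (act∈K r km) })

  -- I · (I^k·K) ⊆ I^(k+1)·K, using that a·_ is an endomorphism of K.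
  augmentation-act-PowMod : ∀ k a {y} → InI a → PowMod k K y → PowMod (suc k) K (act a y)
  augmentation-act-PowMod k a a∈I (gen (r , m , r∈Iᵏ , km , y≈r·m)) =
    gen (a *R r , m , prod a r a∈I r∈Iᵏ , km ,
         trans (act-cong a y≈r·m) (sym (act-*R a r m)))
  augmentation-act-PowMod k a a∈I unit = resp (sym (act-ε a)) unit
  augmentation-act-PowMod k a a∈I (mul p q) =
    resp (sym (act-∙ a (PowMod⊆K k p) (PowMod⊆K k q)))
         (mul (augmentation-act-PowMod k a a∈I p) (augmentation-act-PowMod k a a∈I q))
  augmentation-act-PowMod k a a∈I (inv p) =
    resp (sym (act-⁻¹ a (PowMod⊆K k p))) (inv (augmentation-act-PowMod k a a∈I p))
  augmentation-act-PowMod k a a∈I (resp y≈z p) =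
    resp (act-cong a y≈z) (augmentation-act-PowMod k a a∈I p)

  LCS⊆PowMod : ∀ k {x} → LCS (suc (suc k)) x → PowMod k K x
  LCS⊆PowMod zero {x} kx = gen (ε ∷ [] , x , whole _ , kx , sym (act-unit x))
  LCS⊆PowMod (suc k) = Gen-⊆ (λ { (h , y , y∈LCS , x≈[h,y]) →
    resp (sym (trans x≈[h,y] (commutator≈act h (LCS⊆K k y∈LCS))))
         (augmentation-act-PowMod k (h ∷ ε ∷ []) ≡.refl (LCS⊆PowMod k y∈LCS)) })

proposition3p8 : ∀ {c ℓ : Level} (n : ℕ) (G : Group c ℓ)
    (φ : Group.Carrier G → V n) (g : Fin n → Group.Carrier G) →
    IsExpansionGroup n G φ g →
    (i : ℕ) → 2 ≤ i →
    ∀ x → (GroupNotions.PowMod G (i ∸ 2) (GroupNotions.LCS G 2) x →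
             GroupNotions.LCS G i x)
          × (GroupNotions.LCS G i x →
             GroupNotions.PowMod G (i ∸ 2) (GroupNotions.LCS G 2) x)
proposition3p8 n G φ g E (suc (suc k)) (s≤s (s≤s z≤n)) _ =
  PowMod⊆LCS k , LCS⊆PowMod k
  where
  open IsExpansionGroup E
  open ElementaryAbelianCommutator G
    (λ {x} {y} kx ky → ker-comm x y (comm⊆ker x kx) (comm⊆ker y ky))
    (λ {x} kx → ker-sq x (comm⊆ker x kx))
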